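{- The nonunitary Rota–Baxter algebra $(\mathcal{H}_{\ge0,+},\sqcup,I)$ is generated by $[0]$, i.e. the smallest subspace of $\mathcal{H}_{\ge0,+}$ containing $[0]$ and closed under $\sqcup$ and $I$ is all of $\mathcal{H}_{\ge0,+}$.
   Context: For $n=0,1$ let $\mathcal{H}_{\ge n,+}$ be the $\mathbb{Q}$-vector space with basis the symbols $[s_1,\dots,s_k]$, $k\ge1$, $s_i\in\mathbb{Z}_{\ge n}$. Let $I$ be the linear operator on $\mathcal{H}_{\ge0,+}$ with $I([s_1,s_2,\dots,s_k])=[s_1+1,s_2,\dots,s_k]$. On $\mathcal{H}_{\ge1,+}$ let $\sqcup$ be the product transported from the shuffle product of words: $[\vec s]\sqcup[\vec t]=\eta(\eta^{ -1}[\vec s]\sqcup\!\sqcup\eta^{ -1}[\vec t])$ where $\eta(x_0^{s_1-1}x_1\cdots x_0^{s_k-1}x_1)=[s_1,\dots,s_k]$ and $\sqcup\!\sqcup$ is the shuffle product of words in $x_0,x_1$ ($1\sqcup\!\sqcup w=w\sqcup\!\sqcup1=w$, $(au)\sqcup\!\sqcup(bv)=a(u\sqcup\!\sqcup bv)+b(au\sqcup\!\sqcup v)$). The product $\sqcup$ on $\mathcal{H}_{\ge0,+}$ is the unique commutative associative bilinear product extending this one such that $[0]\sqcup[\vec s]=[0,\vec s]$ for all basis elements $[\vec s]$ and such that $I$ is a Rota–Baxter operator of weight $0$ ($I(a)\sqcup I(b)=I(a\sqcup I(b))+I(I(a)\sqcup b)$); such a product exists and is unique. -}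

module Defs where

open import Data.Nat using (ℕ; zero; suc; _∸_; _≥_)
import Data.Nat as ℕ
open import Data.Bool using (Bool; true; false; if_then_else_)
open import Data.List using (List; []; _∷_; _++_; map; concatMap; replicate; mapMaybe)
open import Data.List.NonEmpty using (List⁺; _∷_; toList; fromList)
open import Data.List.Relation.Unary.All using (All)
import Data.List.Properties as LP
open import Data.Product using (_×_; _,_)
open import Data.Rational using (ℚ; 0ℚ; 1ℚ; _+_; _*_)
open import Relation.Nullary using (yes; no)
open import Relation.Binary.PropositionalEquality using (_≡_)

Sym : Set
Sym = List⁺ ℕ

-- Elements of H_{≥0,+}: finite formal ℚ-linear combinations of symbols.
H : Set
H = List (ℚ × Sym)

coeff : H → Sym → ℚ
coeff [] w = 0ℚ
coeff ((c , v) ∷ xs) w with LP.≡-dec ℕ._≟_ (toList v) (toList w)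
... | yes _ = c + coeff xs w
... | no  _ = coeff xs w

_≈_ : H → H → Set
x ≈ y = ∀ w → coeff x w ≡ coeff y w

infix 4 _≈_

0H : H
0H = []

_+H_ : H → H → H
x +H y = x ++ y

_·H_ : ℚ → H → H
c ·H x = map (λ { (a , w) → (c * a , w) }) x

[_] : Sym → H
[ w ] = (1ℚ , w) ∷ []

[0] : H
[0] = [ 0 ∷ [] ]

cons0 : Sym → Sym
cons0 w = 0 ∷ toList w

incr : Sym → Sym
incr (s ∷ ss) = suc s ∷ ss

I : H → H
I = map (λ { (c , w) → (c , incr w) })

-- words in x₀ (false), x₁ (true) and their shuffle product
shuffleW : List Bool → List Bool → List (List Bool)
shuffleW [] v = v ∷ []
shuffleW (a ∷ u) [] = (a ∷ u) ∷ []
shuffleW (a ∷ u) (b ∷ v) = map (a ∷_) (shuffleW u (b ∷ v)) ++ map (b ∷_) (shuffleW (a ∷ u) v)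

ηinv : Sym → List Bool
ηinv w = concatMap (λ s → replicate (s ∸ 1) false ++ (true ∷ [])) (toList w)

-- η (x₀^{s₁-1} x₁ ⋯ x₀^{sₖ-1} x₁) = [s₁,…,sₖ]
ηList : ℕ → List Bool → List ℕ
ηList n [] = []
ηList n (false ∷ w) = ηList (suc n) w
ηList n (true ∷ w) = suc n ∷ ηList 0 w

shuffleSym : Sym → Sym → H
shuffleSym s t = mapMaybe (λ u → Data.Maybe.map (λ v → (1ℚ , v)) (fromList (ηList 0 u))) (shuffleW (ηinv s) (ηinv t))
  where import Data.Maybe

Pos : Sym → Set
Pos w = All (λ s → s ≥ 1) (toList w)

-- the product ⊔ on H_{≥0,+}: all the properties characterising it
record IsStuffleRB (_⊔_ : H → H → H) : Set where
  field
    ⊔-cong : ∀ {x x' y y'} → x ≈ x' → y ≈ y' → (x ⊔ y) ≈ (x' ⊔ y')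
    ⊔-zeroˡ : ∀ y → (0H ⊔ y) ≈ 0H
    ⊔-distribʳ : ∀ x x' y → ((x +H x') ⊔ y) ≈ ((x ⊔ y) +H (x' ⊔ y))
    ⊔-scaleˡ : ∀ c x y → ((c ·H x) ⊔ y) ≈ (c ·H (x ⊔ y))
    ⊔-zeroʳ : ∀ x → (x ⊔ 0H) ≈ 0H
    ⊔-distribˡ : ∀ x y y' → (x ⊔ (y +H y')) ≈ ((x ⊔ y) +H (x ⊔ y'))
    ⊔-scaleʳ : ∀ c x y → (x ⊔ (c ·H y)) ≈ (c ·H (x ⊔ y))
    ⊔-comm : ∀ x y → (x ⊔ y) ≈ (y ⊔ x)
    ⊔-assoc : ∀ x y z → ((x ⊔ y) ⊔ z) ≈ (x ⊔ (y ⊔ z))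
    ⊔-shuffle : ∀ s t → Pos s → Pos t → ([ s ] ⊔ [ t ]) ≈ shuffleSym s t
    ⊔-[0] : ∀ s → ([0] ⊔ [ s ]) ≈ [ cons0 s ]
    ⊔-RB : ∀ a b → (I a ⊔ I b) ≈ (I (a ⊔ I b) +H I (I a ⊔ b))

record IsRBSubalgebraWith0 (_⊔_ : H → H → H) (S : H → Set) : Set where
  field
    resp : ∀ {x y} → x ≈ y → S x → S y
    has-0H : S 0H
    +-closed : ∀ {x y} → S x → S y → S (x +H y)
    ·-closed : ∀ c {x} → S x → S (c ·H x)
    has-[0] : S [0]
    ⊔-closed : ∀ {x y} → S x → S y → S (x ⊔ y)
    I-closed : ∀ {x} → S x → S (I x)

module Submission where

-- Every basis symbol is reached from [0] by the two generating operations: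
--   [0, s₂, …, sₖ]   = [0] ⊔ [s₂, …, sₖ]       (the defining rule for [0]),
--   [s₁+1, s₂, …, sₖ] = I [s₁, s₂, …, sₖ]      (definition of I),
-- so by induction on the length of the symbol and then on its first entry,
-- every basis vector [s⃗] lies in any subspace S containing [0] and closed
-- under ⊔ and I.  A subspace containing every basis vector contains every
-- finite linear combination of them, i.e. all of H_{≥0,+}.

open import Defs
open import Data.Nat using (ℕ; zero; suc)
open import Data.List using (List; []; _∷_)
open import Data.List.NonEmpty using (_∷_)
open import Data.Product using (_,_)
open import Data.Rational using (ℚ; _*_; 1ℚ)
open import Data.Rational.Properties using (*-identityʳ)
open import Relation.Binary.PropositionalEquality using (refl)

scale-basis : ∀ c w → c ·H [ w ] ≈ ((c , w) ∷ [])
scale-basis c w v rewrite *-identityʳ c = refl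

module _ (S : H → Set)
         (resp : ∀ {x y} → x ≈ y → S x → S y)
         (has-0H : S 0H)
         (+-closed : ∀ {x y} → S x → S y → S (x +H y))
         (·-closed : ∀ c {x} → S x → S (c ·H x)) where

  spanned-by-basis : (∀ w → S [ w ]) → (x : H) → S x
  spanned-by-basis basis [] = has-0H
  spanned-by-basis basis ((c , w) ∷ xs) =
    +-closed {x = (c , w) ∷ []}
             (resp (scale-basis c w) (·-closed c (basis w)))
             (spanned-by-basis basis xs)

basis-generated : (_⊔_ : H → H → H) → IsStuffleRB _⊔_ →
  (S : H → Set) → IsRBSubalgebraWith0 _⊔_ S → (l : List ℕ) (n : ℕ) → S [ n ∷ l ]
basis-generated _⊔_ R S A = go
  where
  open IsStuffleRB R using (⊔-[0])
  open IsRBSubalgebraWith0 A using (resp; has-[0]; ⊔-closed; I-closed)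

  go : (l : List ℕ) (n : ℕ) → S [ n ∷ l ]
  go []      zero    = has-[0]
  go (a ∷ l) zero    = resp (⊔-[0] (a ∷ l)) (⊔-closed has-[0] (go l a))
  go l       (suc n) = I-closed (go l n)

lemma3p4 : (_⊔_ : H → H → H) → IsStuffleRB _⊔_ →
    (S : H → Set) → IsRBSubalgebraWith0 _⊔_ S → (x : H) → S x
lemma3p4 _⊔_ R S A =
  spanned-by-basis S resp has-0H +-closed ·-closed
    (λ { (n ∷ l) → basis-generated _⊔_ R S A l n })
  where open IsRBSubalgebraWith0 A using (resp; has-0H; +-closed; ·-closed)
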